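{- Let $G=(V,E)$ be a simple undirected graph that is minimally $k$-$st$-edge-connected. Then for every $U\subseteq V$, $|E_U|\le\sqrt{2k}\cdot|U|$, where $E_U$ is the set of edges of $E$ with both endpoints in $U$.
   Context: For nodes $s,t\in V$ and a positive integer $k$, $G$ is minimally $k$-$st$-edge-connected if $G$ contains $k$ pairwise edge-disjoint $st$-paths but no proper subgraph of $G$ contains $k$ pairwise edge-disjoint $st$-paths. -}

module Defs where

open import Data.Nat using (ℕ; _≤_; _*_; _+_)
open import Data.Fin using (Fin; _<_)
open import Data.Fin.Subset using (Subset; ∣_∣)
open import Data.Vec using (lookup)
open import Data.Bool using (_∧_)
open import Data.List using (List; []; _∷_; length; filterᵇ)
open import Data.List.Membership.Propositional using (_∈_; _∉_)
open import Data.List.Relation.Unary.All using (All)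
open import Data.List.Relation.Unary.Unique.Propositional using (Unique)
open import Data.Product using (Σ; ∃; _×_; _,_; proj₁; proj₂)
open import Data.Sum using (_⊎_)
open import Relation.Binary.PropositionalEquality using (_≡_; _≢_)
open import Relation.Nullary using (¬_)

-- An edge {u,v} of a graph on vertex set Fin n is stored as an ordered
-- pair (u , v) with u < v (canonical orientation).
Edge : ℕ → Set
Edge n = Fin n × Fin n

-- A simple undirected graph on Fin n: a duplicate-free list of edges,
-- each with u < v (so no loops and no parallel edges).
record SimpleGraph (n : ℕ) : Set where
  constructor mkGraph
  field
    edges     : List (Edge n)
    canonical : All (λ e → proj₁ e < proj₂ e) edges
    noDup     : Unique edges
open SimpleGraph public

Adj : ∀ {n} → List (Edge n) → Fin n → Fin n → Set
Adj E u v = ((u , v) ∈ E) ⊎ ((v , u) ∈ E)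

steps : ∀ {A : Set} → A → List A → List (A × A)
steps x []       = []
steps x (y ∷ ys) = (x , y) ∷ steps y ys

endpoint : ∀ {A : Set} → A → List A → A
endpoint x []       = x
endpoint x (y ∷ ys) = endpoint y ys

-- The list `rest` describes an s-t path s ∷ rest in the graph with edge
-- list E: it ends at t, has pairwise distinct vertices, and consecutive
-- vertices are adjacent in E.
IsPath : ∀ {n} → List (Edge n) → Fin n → Fin n → List (Fin n) → Set
IsPath E s t rest =
  (endpoint s rest ≡ t) × Unique (s ∷ rest) × All (λ p → Adj E (proj₁ p) (proj₂ p)) (steps s rest)

SameEdge : ∀ {n} → Edge n → Edge n → Set
SameEdge (a , b) (c , d) = ((a ≡ c) × (b ≡ d)) ⊎ ((a ≡ d) × (b ≡ c))

EdgeDisjoint : ∀ {n} → Fin n → List (Fin n) → List (Fin n) → Set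
EdgeDisjoint s p q =
  ∀ e f → e ∈ steps s p → f ∈ steps s q → ¬ SameEdge e f

HasDisjointPaths : ∀ {n} → List (Edge n) → Fin n → Fin n → ℕ → Set
HasDisjointPaths {n} E s t k =
  Σ (Fin k → List (Fin n)) λ P →
    (∀ i → IsPath E s t (P i)) × (∀ i j → i ≢ j → EdgeDisjoint s (P i) (P j))

MinimallyEdgeConnected : ∀ {n} → SimpleGraph n → Fin n → Fin n → ℕ → Set
MinimallyEdgeConnected {n} G s t k =
  HasDisjointPaths (edges G) s t k ×
  (∀ (E' : List (Edge n)) → All (_∈ edges G) E' →
     (∃ λ e → (e ∈ edges G) × (e ∉ E')) →
     ¬ HasDisjointPaths E' s t k)

inducedEdges : ∀ {n} → SimpleGraph n → Subset n → List (Edge n)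
inducedEdges G U = filterᵇ (λ e → lookup U (proj₁ e) ∧ lookup U (proj₂ e)) (edges G)

{-# OPTIONS --safe #-}
module Submission where

-- Orient the edges of the k edge-disjoint s-t paths along the paths: this gives
-- a 0/1 flow of value k from s to t. Minimality forces every edge of G to be used, and it
-- forces the orientation to be acyclic: after deleting the arcs of a directed
-- cycle a flow of value k remains, and its decomposition into k arc-disjoint
-- paths would avoid an edge of G. Rank the vertices of U along a topological
-- order and send an edge of E_U going from rank r to rank r + d to the pair
-- (r + d , d). These pairs are distinct with r + d < |U|, so at most |U| of
-- them share a value of d, while along each path the values d add up to at most
-- |U|. Hence |E_U|² + |E_U|·|U| ≤ 2|U|·Σd ≤ 2k|U|².

open import Data.Bool using (Bool; true; false; _∧_; _∨_; not; if_then_else_)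
open import Data.Bool.Properties
  using (∨-identityʳ; ∨-zeroʳ; ∧-identityʳ; ∧-zeroʳ; ¬-not; T-≡) renaming (_≟_ to _≟ᵇ_)
open import Data.Empty using (⊥; ⊥-elim)
open import Data.Fin using (Fin; zero; suc) renaming (_<_ to _<ᶠ_)
open import Data.Fin.Properties using (_≟_)
  renaming (suc-injective to suc-injectiveᶠ; <-asym to <ᶠ-asym; <-irrefl to <ᶠ-irrefl)
open import Data.Fin.Subset using (Subset; ∣_∣)
open import Data.List using (List; []; _∷_; _++_; [_]; map; length; filter; filterᵇ; concatMap; allFin; upTo)
open import Data.List.Properties using (filter-notAll; map-++; length-map; length-upTo)
open import Data.List.Membership.Propositional using (_∈_; _∉_; find)
open import Data.List.Relation.Binary.Subset.Propositional using (_⊆_)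
open import Data.List.Relation.Binary.Subset.Propositional.Properties using (∷⁺ʳ)
open import Data.List.Relation.Unary.All using (All; []; _∷_)
open import Data.List.Relation.Unary.AllPairs using ([]; _∷_)
open import Data.List.Relation.Unary.Any using (here; there; any?)
open import Data.List.Relation.Unary.Unique.Propositional using (Unique)
open import Data.List.Relation.Unary.Unique.Propositional.Properties using (filter⁺)
open import Data.Nat using (ℕ; zero; suc; _≤_; _<_; _+_; _*_; _∸_; z≤n; s≤s; z<s; _<?_; _<ᵇ_)
open import Data.Nat.ListAction using () renaming (sum to sumˡ)
open import Data.Nat.ListAction.Properties using (sum-++)
open import Data.Nat.Properties hiding (_≟_)
open import Algebra.Properties.CommutativeSemigroup +-commutativeSemigroup using (x∙yz≈y∙xz)
open import Algebra.Properties.CommutativeMonoid.Sum +-0-commutativeMonoid using (∑-distrib-+)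
open import Algebra.Properties.Monoid.Sum +-0-monoid using (sum; sum-cong-≗; sum-replicate-zero)
open import Data.Nat.Tactic.RingSolver using (solve-∀)
open import Data.Product using (Σ; ∃; ∃₂; _×_; _,_; proj₁; proj₂)
open import Data.Sum using (_⊎_; inj₁; inj₂; [_,_]′)
open import Data.Vec using (lookup)
open import Defs
open import Function using (_∘_; id; const)
open import Function.Bundles using (Equivalence)
open import Function.Definitions using (Injective)
open import Relation.Binary using (tri<; tri≈; tri>)
open import Relation.Binary.PropositionalEquality hiding ([_])
open import Relation.Nullary using (¬_; yes; no; does; ¬?)
open import Relation.Nullary.Decidable using (dec-true; dec-false; T?)
import Data.List.Membership.Propositional.Properties as ∈
import Data.List.Relation.Unary.All as All
import Data.List.Relation.Unary.All.Properties as All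
import Data.List.Relation.Unary.Any as Any
import Data.Vec as Vec

true≢false : true ≢ false
true≢false ()

∨-trueʳ : ∀ a {b} → b ≡ true → a ∨ b ≡ true
∨-trueʳ a refl = ∨-zeroʳ a

∧-≡true : ∀ {a b} → a ∧ b ≡ true → a ≡ true × b ≡ true
∧-≡true {true} b≡true = refl , b≡true

∧-≡false : ∀ {a b} → (a ≡ true → b ≡ true → ⊥) → a ∧ b ≡ false
∧-≡false {false}         _    = refl
∧-≡false {true}  {false} _    = refl
∧-≡false {true}  {true}  ¬both = ⊥-elim (¬both refl refl)

∧-not-∨ : ∀ m k → (k ≡ true → m ≡ true) → (m ∧ not k) ∨ k ≡ m
∧-not-∨ true  true  _   = refl
∧-not-∨ false true  k⇒m = sym (k⇒m refl)
∧-not-∨ true  false _   = refl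
∧-not-∨ false false _   = refl

∧-not-∧ : ∀ m k → (m ∧ not k) ∧ k ≡ false
∧-not-∧ true  true  = refl
∧-not-∧ true  false = refl
∧-not-∧ false k     = refl

sum-mono-≤ : ∀ {n} {f g : Fin n → ℕ} → (∀ i → f i ≤ g i) → sum f ≤ sum g
sum-mono-≤ {zero}  f≤g = z≤n
sum-mono-≤ {suc n} f≤g = +-mono-≤ (f≤g zero) (sum-mono-≤ (f≤g ∘ suc))

sum-mono-< : ∀ {n} {f g : Fin n → ℕ} → (∀ i → f i ≤ g i) → ∀ a → f a < g a → sum f < sum g
sum-mono-< f≤g zero    fa<ga = +-mono-<-≤ fa<ga (sum-mono-≤ (f≤g ∘ suc))
sum-mono-< f≤g (suc a) fa<ga = +-mono-≤-< (f≤g zero) (sum-mono-< (f≤g ∘ suc) a fa<ga)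

term≤sum : ∀ {n} (f : Fin n → ℕ) a → f a ≤ sum f
term≤sum f zero    = m≤m+n _ _
term≤sum f (suc a) = ≤-trans (term≤sum (f ∘ suc) a) (m≤n+m _ _)

sum>0⇒term>0 : ∀ {n} (f : Fin n → ℕ) → 0 < sum f → ∃ λ i → 0 < f i
sum>0⇒term>0 {suc n} f 0<Σ with f zero in fzero≡
... | suc _ = zero , subst (0 <_) (sym fzero≡) z<s
... | zero  = let i , 0<fi = sum>0⇒term>0 (f ∘ suc) 0<Σ in suc i , 0<fi

χ : Bool → ℕ
χ true  = 1
χ false = 0

χ-mono : ∀ {a b} → (a ≡ true → b ≡ true) → χ a ≤ χ b
χ-mono {false} a⇒b = z≤n
χ-mono {true}  a⇒b rewrite a⇒b refl = ≤-refl

χ>0⇒true : ∀ {b} → 0 < χ b → b ≡ true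
χ>0⇒true {true} _ = refl

χ-∨ : ∀ a b → a ∧ b ≡ false → χ (a ∨ b) ≡ χ a + χ b
χ-∨ true  false _ = refl
χ-∨ false b     _ = refl

count : ∀ {n} → (Fin n → Bool) → ℕ
count p = sum (χ ∘ p)

count-cong : ∀ {n} {p q : Fin n → Bool} → (∀ i → p i ≡ q i) → count p ≡ count q
count-cong p≗q = sum-cong-≗ (cong χ ∘ p≗q)

count-false : ∀ {n} {p : Fin n → Bool} → (∀ i → p i ≡ false) → count p ≡ 0
count-false {n} p≗false = trans (count-cong p≗false) (sum-replicate-zero n)

count-mono-≤ : ∀ {n} {p q : Fin n → Bool} → (∀ i → p i ≡ true → q i ≡ true) → count p ≤ count q
count-mono-≤ p⇒q = sum-mono-≤ (χ-mono ∘ p⇒q)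

count-mono-< : ∀ {n} {p q : Fin n → Bool} → (∀ i → p i ≡ true → q i ≡ true) →
  ∀ a → p a ≡ false → q a ≡ true → count p < count q
count-mono-< p⇒q a pa qa = sum-mono-< (χ-mono ∘ p⇒q) a (subst₂ (λ x y → χ x < χ y) (sym pa) (sym qa) z<s)

count>0⇒∃ : ∀ {n} (p : Fin n → Bool) → 0 < count p → ∃ λ i → p i ≡ true
count>0⇒∃ p 0<count = let i , 0<χ = sum>0⇒term>0 (χ ∘ p) 0<count in i , χ>0⇒true 0<χ

count-∨ : ∀ {n} (p q : Fin n → Bool) → (∀ i → p i ∧ q i ≡ false) →
  count (λ i → p i ∨ q i) ≡ count p + count q
count-∨ p q disjoint = trans (sum-cong-≗ (λ i → χ-∨ (p i) (q i) (disjoint i))) (∑-distrib-+ (χ ∘ p) (χ ∘ q))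

count-≟ : ∀ {n} (b : Fin n) → count (λ y → does (y ≟ b)) ≡ 1
count-≟ {suc n} zero = cong suc (count-false {n} {λ _ → false} (λ _ → refl))
count-≟ (suc b)      = count-≟ b

∣p∣≡count : ∀ {n} (p : Subset n) → ∣ p ∣ ≡ count (lookup p)
∣p∣≡count Vec.[]          = refl
∣p∣≡count (true  Vec.∷ p) = cong suc (∣p∣≡count p)
∣p∣≡count (false Vec.∷ p) = ∣p∣≡count p

δ : ∀ {n} → Fin n → Fin n → ℕ
δ x y = χ (does (x ≟ y))

δ-refl : ∀ {n} (x : Fin n) → δ x x ≡ 1
δ-refl x = cong χ (dec-true (x ≟ x) refl)

δ-≢ : ∀ {n} {x y : Fin n} → x ≢ y → δ x y ≡ 0
δ-≢ {x = x} {y} x≢y = cong χ (dec-false (x ≟ y) x≢y)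

+-δ-refl : ∀ {n} m (x : Fin n) → m + δ x x ≡ suc m
+-δ-refl m x = trans (cong (m +_) (δ-refl x)) (+-comm m 1)

+-δ-≢ : ∀ {n} m {x y : Fin n} → x ≢ y → m + δ x y ≡ m
+-δ-≢ m x≢y = trans (cong (m +_) (δ-≢ x≢y)) (+-identityʳ m)

module _ {A : Set} where

  ∈-++-∷⇒∈-++ : ∀ {v x : A} xs ys → v ∈ xs ++ x ∷ ys → v ≢ x → v ∈ xs ++ ys
  ∈-++-∷⇒∈-++ xs ys v∈ v≢x with ∈.∈-++⁻ xs v∈
  ... | inj₁ v∈xs         = ∈.∈-++⁺ˡ v∈xs
  ... | inj₂ (here v≡x)   = ⊥-elim (v≢x v≡x)
  ... | inj₂ (there v∈ys) = ∈.∈-++⁺ʳ xs v∈ys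

  sum-map-⊆ : ∀ (g : A → ℕ) {xs R} → Unique xs → All (_∈ R) xs → sumˡ (map g xs) ≤ sumˡ (map g R)
  sum-map-⊆ g {[]}     _                  _            = z≤n
  sum-map-⊆ g {x ∷ xs} (x∉xs ∷ xs-unique) (x∈R ∷ xs⊆R) with ∈.∈-∃++ x∈R
  ... | R₁ , R₂ , refl = begin
    g x + sumˡ (map g xs)                     ≤⟨ +-monoʳ-≤ (g x) (sum-map-⊆ g xs-unique xs⊆R₁++R₂) ⟩
    g x + sumˡ (map g (R₁ ++ R₂))             ≡⟨ cong (λ l → g x + sumˡ l) (map-++ g R₁ R₂) ⟩
    g x + sumˡ (map g R₁ ++ map g R₂)         ≡⟨ cong (g x +_) (sum-++ (map g R₁) _) ⟩
    g x + (sumˡ (map g R₁) + sumˡ (map g R₂)) ≡⟨ x∙yz≈y∙xz (g x) (sumˡ (map g R₁)) _ ⟩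
    sumˡ (map g R₁) + (g x + sumˡ (map g R₂)) ≡⟨ sum-++ (map g R₁) _ ⟨
    sumˡ (map g R₁ ++ map g (x ∷ R₂))         ≡⟨ cong sumˡ (map-++ g R₁ (x ∷ R₂)) ⟨
    sumˡ (map g (R₁ ++ x ∷ R₂))               ∎
    where
    open ≤-Reasoning
    xs⊆R₁++R₂ : All (_∈ R₁ ++ R₂) xs
    xs⊆R₁++R₂ = All.zipWith (λ (y∈R , x≢y) → ∈-++-∷⇒∈-++ R₁ R₂ y∈R (x≢y ∘ sym)) (xs⊆R , x∉xs)

  length-⊆ : ∀ {xs R : List A} → Unique xs → All (_∈ R) xs → length xs ≤ length R
  length-⊆ {xs} {R} xs-unique xs⊆R =
    subst₂ _≤_ (sum-map-1 xs) (sum-map-1 R) (sum-map-⊆ (const 1) xs-unique xs⊆R)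
    where
    sum-map-1 : ∀ l → sumˡ (map (const 1) l) ≡ length l
    sum-map-1 []      = refl
    sum-map-1 (_ ∷ l) = cong suc (sum-map-1 l)

  map-unique : ∀ {B : Set} (f : A → B) {xs} → Unique xs →
    (∀ {a b} → a ∈ xs → b ∈ xs → f a ≡ f b → a ≡ b) → Unique (map f xs)
  map-unique f {[]}     _                  _         = []
  map-unique f {x ∷ xs} (x∉xs ∷ xs-unique) injective =
    All.map⁺ (All.tabulate (λ y∈xs fx≡fy → All.lookup x∉xs y∈xs (injective (here refl) (there y∈xs) fx≡fy)))
      ∷ map-unique f xs-unique (λ a∈ b∈ → injective (there a∈) (there b∈))

module _ {A : Set} (p : A → Bool) where

  ∈-filterᵇ⁻ : ∀ {x xs} → x ∈ filterᵇ p xs → x ∈ xs × p x ≡ true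
  ∈-filterᵇ⁻ x∈ = let x∈xs , px = ∈.∈-filter⁻ (T? ∘ p) x∈ in x∈xs , Equivalence.to T-≡ px

  ∈-filterᵇ⁺ : ∀ {x xs} → x ∈ xs → p x ≡ true → x ∈ filterᵇ p xs
  ∈-filterᵇ⁺ x∈xs px = ∈.∈-filter⁺ (T? ∘ p) x∈xs (Equivalence.from T-≡ px)

-- Digraphs, degrees and walks

Arc : ℕ → Set
Arc n = Fin n × Fin n

Digraph : ℕ → Set
Digraph n = Fin n → Fin n → Bool

module _ {n : ℕ} where

  open import Data.List.Membership.DecPropositional (_≟_ {n}) using (_∈?_)

  infix 4 _⊆ᵈ_
  infixl 6 _∖_

  _⊆ᵈ_ : Digraph n → Digraph n → Set
  N ⊆ᵈ M = ∀ x y → N x y ≡ true → M x y ≡ true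

  _∪_ _∖_ : Digraph n → Digraph n → Digraph n
  (M ∪ N) x y = M x y ∨ N x y
  (M ∖ N) x y = M x y ∧ not (N x y)

  ∖-⊆ᵈ : ∀ M N → M ∖ N ⊆ᵈ M
  ∖-⊆ᵈ M N x y h with M x y
  ... | true = refl

  ∖-removes : ∀ M N {x y} → N x y ≡ true → (M ∖ N) x y ≡ false
  ∖-removes M N {x} {y} Nxy rewrite Nxy = ∧-zeroʳ (M x y)

  Irreflexive : Digraph n → Set
  Irreflexive M = ∀ x → M x x ≡ false

  ⊆ᵈ-irreflexive : ∀ {M N} → N ⊆ᵈ M → Irreflexive M → Irreflexive N
  ⊆ᵈ-irreflexive {N = N} N⊆M irr x with N x x in Nxx
  ... | false = refl
  ... | true  = trans (sym (N⊆M x x Nxx)) (irr x)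

  irreflexive⇒≢ : ∀ {M} → Irreflexive M → ∀ {x y} → M x y ≡ true → x ≢ y
  irreflexive⇒≢ irr Mxy refl = true≢false (trans (sym Mxy) (irr _))

  fromArcs : List (Arc n) → Digraph n
  fromArcs []            x y = false
  fromArcs ((a , b) ∷ A) x y = (does (x ≟ a) ∧ does (y ≟ b)) ∨ fromArcs A x y

  fromArcs-sound : ∀ A {x y} → fromArcs A x y ≡ true → (x , y) ∈ A
  fromArcs-sound ((a , b) ∷ A) {x} {y} h with x ≟ a | y ≟ b
  ... | yes refl | yes refl = here refl
  ... | yes refl | no _     = there (fromArcs-sound A h)
  ... | no _     | _        = there (fromArcs-sound A h)

  fromArcs-complete : ∀ A {x y} → (x , y) ∈ A → fromArcs A x y ≡ true
  fromArcs-complete ((a , b) ∷ A) (here refl) rewrite dec-true (a ≟ a) refl | dec-true (b ≟ b) refl = refl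
  fromArcs-complete (_ ∷ A)       (there xy∈A) = ∨-trueʳ _ (fromArcs-complete A xy∈A)

  fromArcs-false : ∀ A {x y} → (x , y) ∉ A → fromArcs A x y ≡ false
  fromArcs-false A {x} {y} xy∉A with fromArcs A x y in Axy
  ... | false = refl
  ... | true  = ⊥-elim (xy∉A (fromArcs-sound A Axy))

  ArcsIn : Digraph n → List (Arc n) → Set
  ArcsIn M = All (λ e → M (proj₁ e) (proj₂ e) ≡ true)

  fromArcs-⊆ᵈ : ∀ {M} A → ArcsIn M A → fromArcs A ⊆ᵈ M
  fromArcs-⊆ᵈ A A⊆M x y h = All.lookup A⊆M (fromArcs-sound A h)

  outdeg indeg : Digraph n → Fin n → ℕ
  outdeg M v = count (M v)
  indeg  M v = count (λ x → M x v)

  outdeg-∷ : ∀ a b A → a ∉ map proj₁ A → ∀ v →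
    outdeg (fromArcs ((a , b) ∷ A)) v ≡ δ v a + outdeg (fromArcs A) v
  outdeg-∷ a b A a∉A v with v ≟ a
  ... | no _     = refl
  ... | yes refl = begin
    count (λ y → does (y ≟ b) ∨ fromArcs A a y)
      ≡⟨ count-cong (λ y → trans (cong (_ ∨_) (no-arc y)) (∨-identityʳ _)) ⟩
    count (λ y → does (y ≟ b)) ≡⟨ count-≟ b ⟩
    1                          ≡⟨ cong suc (count-false no-arc) ⟨
    1 + outdeg (fromArcs A) a  ∎
    where
    open ≡-Reasoning
    no-arc : ∀ y → fromArcs A a y ≡ false
    no-arc y = fromArcs-false A (a∉A ∘ ∈.∈-map⁺ proj₁)

  indeg-∷ : ∀ a b A → b ∉ map proj₂ A → ∀ v →
    indeg (fromArcs ((a , b) ∷ A)) v ≡ δ v b + indeg (fromArcs A) v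
  indeg-∷ a b A b∉A v with v ≟ b
  ... | no _     = count-cong (λ x → cong (_∨ fromArcs A x v) (∧-zeroʳ (does (x ≟ a))))
  ... | yes refl = begin
    count (λ x → (does (x ≟ a) ∧ true) ∨ fromArcs A x b)
      ≡⟨ count-cong (λ x → trans (cong₂ _∨_ (∧-identityʳ _) (no-arc x)) (∨-identityʳ _)) ⟩
    count (λ x → does (x ≟ a)) ≡⟨ count-≟ a ⟩
    1                          ≡⟨ cong suc (count-false {p = λ x → fromArcs A x b} no-arc) ⟨
    1 + indeg (fromArcs A) b   ∎
    where
    open ≡-Reasoning
    no-arc : ∀ x → fromArcs A x b ≡ false
    no-arc x = fromArcs-false A (b∉A ∘ ∈.∈-map⁺ proj₂)

  outdeg-arc : ∀ (a b v : Fin n) → outdeg (fromArcs [ (a , b) ]) v ≡ δ v a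
  outdeg-arc a b v = trans (outdeg-∷ a b [] (λ ()) v)
    (trans (cong (δ v a +_) (count-false {p = fromArcs [] v} (λ _ → refl))) (+-identityʳ _))

  indeg-arc : ∀ (a b v : Fin n) → indeg (fromArcs [ (a , b) ]) v ≡ δ v b
  indeg-arc a b v = trans (indeg-∷ a b [] (λ ()) v)
    (trans (cong (δ v b +_) (count-false {p = λ x → fromArcs [] x v} (λ _ → refl))) (+-identityʳ _))

  outdeg-∖ : ∀ M N → N ⊆ᵈ M → ∀ v → outdeg M v ≡ outdeg (M ∖ N) v + outdeg N v
  outdeg-∖ M N N⊆M v = trans (count-cong {n} (λ y → sym (∧-not-∨ (M v y) (N v y) (N⊆M v y))))
                             (count-∨ {n} _ _ (λ y → ∧-not-∧ (M v y) (N v y)))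

  indeg-∖ : ∀ M N → N ⊆ᵈ M → ∀ v → indeg M v ≡ indeg (M ∖ N) v + indeg N v
  indeg-∖ M N N⊆M v = trans (count-cong {n} (λ x → sym (∧-not-∨ (M x v) (N x v) (N⊆M x v))))
                            (count-∨ {n} _ _ (λ x → ∧-not-∧ (M x v) (N x v)))

  outdeg-∪ : ∀ M N → (∀ x y → M x y ∧ N x y ≡ false) → ∀ v → outdeg (M ∪ N) v ≡ outdeg M v + outdeg N v
  outdeg-∪ M N disjoint v = count-∨ {n} _ _ (disjoint v)

  indeg-∪ : ∀ M N → (∀ x y → M x y ∧ N x y ≡ false) → ∀ v → indeg (M ∪ N) v ≡ indeg M v + indeg N v
  indeg-∪ M N disjoint v = count-∨ {n} _ _ (λ x → disjoint x v)

  heads-steps : ∀ (a : Fin n) l → map proj₂ (steps a l) ≡ l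
  heads-steps a []      = refl
  heads-steps a (b ∷ l) = cong (b ∷_) (heads-steps b l)

  tails-steps⊆ : ∀ (a : Fin n) l {x} → x ∈ map proj₁ (steps a l) → x ∈ a ∷ l
  tails-steps⊆ a (b ∷ l) (here refl) = here refl
  tails-steps⊆ a (b ∷ l) (there x∈)  = there (tails-steps⊆ b l x∈)

  unique-tails : ∀ (a : Fin n) l → Unique (a ∷ l) → Unique (map proj₁ (steps a l))
  unique-tails a []      _              = []
  unique-tails a (b ∷ l) (a∉ ∷ b∷l-unique) =
    All.tabulate (All.lookup a∉ ∘ tails-steps⊆ b l) ∷ unique-tails b l b∷l-unique

  steps-antisymmetric : ∀ (a : Fin n) l → Unique (a ∷ l) →
    ∀ {x y} → (x , y) ∈ steps a l → (y , x) ∈ steps a l → ⊥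
  steps-antisymmetric a (b ∷ l) (a∉ ∷ _) (here refl) (here refl) = All.lookup a∉ (here refl) refl
  steps-antisymmetric a (b ∷ l) (a∉ ∷ _) (here refl) (there ba∈) =
    All.lookup a∉ (there (subst (a ∈_) (heads-steps b l) (∈.∈-map⁺ proj₂ ba∈))) refl
  steps-antisymmetric a (b ∷ l) (a∉ ∷ _) (there ab∈) (here refl) =
    All.lookup a∉ (there (subst (a ∈_) (heads-steps b l) (∈.∈-map⁺ proj₂ ab∈))) refl
  steps-antisymmetric a (b ∷ l) (_ ∷ unique) (there xy∈) (there yx∈) = steps-antisymmetric b l unique xy∈ yx∈

  walk-degree-balance : ∀ (a : Fin n) l → Unique (map proj₁ (steps a l)) → Unique l → ∀ v →
    outdeg (fromArcs (steps a l)) v + δ v (endpoint a l) ≡ indeg (fromArcs (steps a l)) v + δ v a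
  walk-degree-balance a []      _               _          v = refl
  walk-degree-balance a (b ∷ l) (a∉ ∷ tails-u) (b∉ ∷ l-u) v = begin
    outdeg A v + δ v e            ≡⟨ cong (_+ δ v e) (outdeg-∷ a b (steps b l) (All.All¬⇒¬Any a∉) v) ⟩
    δ v a + outdeg A' v + δ v e   ≡⟨ +-assoc (δ v a) _ _ ⟩
    δ v a + (outdeg A' v + δ v e) ≡⟨ cong (δ v a +_) (walk-degree-balance b l tails-u l-u v) ⟩
    δ v a + (indeg A' v + δ v b)  ≡⟨ +-comm (δ v a) _ ⟩
    indeg A' v + δ v b + δ v a    ≡⟨ cong (_+ δ v a) (+-comm _ (δ v b)) ⟩
    δ v b + indeg A' v + δ v a    ≡⟨ cong (_+ δ v a) (indeg-∷ a b (steps b l) b∉heads v) ⟨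
    indeg A v + δ v a             ∎
    where
    open ≡-Reasoning
    A  = fromArcs (steps a (b ∷ l))
    A' = fromArcs (steps b l)
    e  = endpoint b l
    b∉heads : b ∉ map proj₂ (steps b l)
    b∉heads = subst (b ∉_) (sym (heads-steps b l)) (All.All¬⇒¬Any b∉)

  PathIn : Digraph n → Fin n → List (Fin n) → Set
  PathIn M a p = Unique (a ∷ p) × ArcsIn M (steps a p)

  ⊆ᵈ-path : ∀ {M N a p} → N ⊆ᵈ M → PathIn N a p → PathIn M a p
  ⊆ᵈ-path N⊆M (unique , arcs) = unique , All.map (λ {e} → N⊆M (proj₁ e) (proj₂ e)) arcs

  suffix-from : ∀ {M} a v q → a ∈ v ∷ q → PathIn M v q →
    ∃ λ p → PathIn M a p × endpoint a p ≡ endpoint v q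
  suffix-from a v q       (here refl) path = q , path , refl
  suffix-from a v []      (there ())
  suffix-from a v (w ∷ q) (there a∈)  (_ ∷ unique , _ ∷ arcs) = suffix-from a w q a∈ (unique , arcs)

  prepend-arc : ∀ {M} a v q → M a v ≡ true → PathIn M v q →
    ∃ λ p → PathIn M a p × endpoint a p ≡ endpoint v q
  prepend-arc a v q Mav path with a ∈? v ∷ q
  ... | yes a∈ = suffix-from a v q a∈ path
  ... | no  a∉ = v ∷ q , (All.¬Any⇒All¬ (v ∷ q) a∉ ∷ proj₁ path , Mav ∷ proj₂ path) , refl

  Surplus Deficit : Digraph n → Fin n → Set
  Surplus M v = indeg M v < outdeg M v
  Deficit M v = outdeg M v < indeg M v

  size : Digraph n → ℕ
  size M = sum (outdeg M)

  path-to-deficit : ∀ f M a → size M ≤ f → Irreflexive M → Surplus M a →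
    ∃ λ p → PathIn M a p × Deficit M (endpoint a p)
  path-to-deficit zero M a size≤0 _ a-surplus =
    ⊥-elim (n≮0 (≤-trans (m<n⇒0<n a-surplus) (≤-trans (term≤sum (outdeg M) a) size≤0)))
  path-to-deficit (suc f) M a size≤ irr a-surplus with count>0⇒∃ (M a) (m<n⇒0<n a-surplus)
  ... | v , Mav with outdeg M v <? indeg M v
  ...   | yes v-deficit = [ v ] , ((irreflexive⇒≢ {M} irr Mav ∷ []) ∷ [] ∷ [] , Mav ∷ []) , v-deficit
  ...   | no ¬v-deficit =
    let q , q-path , w-deficit = path-to-deficit f M' v size'≤ (⊆ᵈ-irreflexive M'⊆M irr) v-surplus
        p , p-path , p≡q = prepend-arc a v q Mav (⊆ᵈ-path M'⊆M q-path)
    in  p , p-path , subst (Deficit M) (sym p≡q) (deficit-in-M w-deficit)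
    where
    a≢v = irreflexive⇒≢ {M} irr Mav
    M' = M ∖ fromArcs [ (a , v) ]
    M'⊆M = ∖-⊆ᵈ M (fromArcs [ (a , v) ])
    arc⊆M = fromArcs-⊆ᵈ [ (a , v) ] (Mav ∷ [])
    out≡ : ∀ x → outdeg M x ≡ outdeg M' x + δ x a
    out≡ x = trans (outdeg-∖ M _ arc⊆M x) (cong (outdeg M' x +_) (outdeg-arc a v x))
    in≡ : ∀ x → indeg M x ≡ indeg M' x + δ x v
    in≡ x = trans (indeg-∖ M _ arc⊆M x) (cong (indeg M' x +_) (indeg-arc a v x))
    size'≤ : size M' ≤ f
    size'≤ = ≤-pred (≤-trans (sum-mono-< (λ x → subst (outdeg M' x ≤_) (sym (out≡ x)) (m≤m+n _ _)) a
                                          (≤-reflexive (sym (trans (out≡ a) (+-δ-refl _ a)))))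
                             size≤)
    v-surplus : Surplus M' v
    v-surplus = subst₂ _≤_ (trans (in≡ v) (+-δ-refl _ v)) (trans (out≡ v) (+-δ-≢ _ (a≢v ∘ sym)))
                          (≮⇒≥ ¬v-deficit)
    a-not-deficit : ¬ Deficit M' a
    a-not-deficit a-deficit = <⇒≱ a-deficit (≤-pred (subst₂ _<_ (trans (in≡ a) (+-δ-≢ _ a≢v))
                                                                (trans (out≡ a) (+-δ-refl _ a)) a-surplus))
    deficit-in-M : ∀ {w} → Deficit M' w → Deficit M w
    deficit-in-M {w} w-deficit = subst₂ _<_ (sym (trans (out≡ w) (+-δ-≢ _ w≢a))) (sym (in≡ w))
                                            (<-≤-trans w-deficit (m≤m+n _ _))
      where
      w≢a : w ≢ a
      w≢a refl = a-not-deficit w-deficit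

-- Flows and their decomposition into paths

module _ {n : ℕ} (s t : Fin n) where

  -- M, read as a 0/1 flow, satisfies conservation except for j units leaving s and entering t.
  IsFlow : Digraph n → ℕ → Set
  IsFlow M j = ∀ v → outdeg M v + j * δ v t ≡ indeg M v + j * δ v s

  isFlow-∖ : ∀ {M N} c j → N ⊆ᵈ M → IsFlow N c → IsFlow M (c + j) → IsFlow (M ∖ N) j
  isFlow-∖ {M} {N} c j N⊆M N-flow M-flow v = +-cancelʳ-≡ (outdeg N v + c * δ v t) _ _ (begin
    outdeg (M ∖ N) v + j * δ v t + (outdeg N v + c * δ v t) ≡⟨ regroup (outdeg (M ∖ N) v) (outdeg N v) c j (δ v t) ⟩
    outdeg (M ∖ N) v + outdeg N v + (c + j) * δ v t         ≡⟨ cong (_+ _) (outdeg-∖ M N N⊆M v) ⟨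
    outdeg M v + (c + j) * δ v t                            ≡⟨ M-flow v ⟩
    indeg M v + (c + j) * δ v s                             ≡⟨ cong (_+ _) (indeg-∖ M N N⊆M v) ⟩
    indeg (M ∖ N) v + indeg N v + (c + j) * δ v s           ≡⟨ regroup (indeg (M ∖ N) v) (indeg N v) c j (δ v s) ⟨
    indeg (M ∖ N) v + j * δ v s + (indeg N v + c * δ v s)   ≡⟨ cong (indeg (M ∖ N) v + j * δ v s +_) (N-flow v) ⟨
    indeg (M ∖ N) v + j * δ v s + (outdeg N v + c * δ v t)  ∎)
    where
    open ≡-Reasoning
    regroup : ∀ a b c j d → a + j * d + (b + c * d) ≡ a + b + (c + j) * d
    regroup = solve-∀

  isFlow-∪ : ∀ {M N} c j → (∀ x y → M x y ∧ N x y ≡ false) →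
    IsFlow M c → IsFlow N j → IsFlow (M ∪ N) (c + j)
  isFlow-∪ {M} {N} c j disjoint M-flow N-flow v = begin
    outdeg (M ∪ N) v + (c + j) * δ v t                 ≡⟨ cong (_+ _) (outdeg-∪ M N disjoint v) ⟩
    outdeg M v + outdeg N v + (c + j) * δ v t           ≡⟨ regroup (outdeg M v) (outdeg N v) c j (δ v t) ⟩
    (outdeg M v + c * δ v t) + (outdeg N v + j * δ v t) ≡⟨ cong₂ _+_ (M-flow v) (N-flow v) ⟩
    (indeg M v + c * δ v s) + (indeg N v + j * δ v s)   ≡⟨ regroup (indeg M v) (indeg N v) c j (δ v s) ⟨
    indeg M v + indeg N v + (c + j) * δ v s             ≡⟨ cong (_+ _) (indeg-∪ M N disjoint v) ⟨
    indeg (M ∪ N) v + (c + j) * δ v s                   ∎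
    where
    open ≡-Reasoning
    regroup : ∀ a b c j d → a + b + (c + j) * d ≡ (a + c * d) + (b + j * d)
    regroup = solve-∀

  path-isFlow : ∀ p → Unique (s ∷ p) → endpoint s p ≡ t → IsFlow (fromArcs (steps s p)) 1
  path-isFlow p s∷p-unique@(_ ∷ p-unique) p-end v =
    subst₂ (λ x y → outdeg (fromArcs (steps s p)) v + x ≡ indeg (fromArcs (steps s p)) v + y)
           (sym (+-identityʳ _)) (sym (+-identityʳ _))
           (subst (λ e → _ + δ v e ≡ _) p-end (walk-degree-balance s p (unique-tails s p s∷p-unique) p-unique v))

  isFlow-surplus : ∀ {M j} → s ≢ t → IsFlow M (suc j) → Surplus M s
  isFlow-surplus {M} {j} s≢t M-flow = begin-strict
    indeg M s                  <⟨ m<m+n _ z<s ⟩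
    indeg M s + suc j          ≡⟨ cong (indeg M s +_) (*-identityʳ (suc j)) ⟨
    indeg M s + suc j * 1      ≡⟨ cong (λ d → indeg M s + suc j * d) (δ-refl s) ⟨
    indeg M s + suc j * δ s s  ≡⟨ M-flow s ⟨
    outdeg M s + suc j * δ s t ≡⟨ cong (outdeg M s +_) (trans (cong (suc j *_) (δ-≢ s≢t)) (*-zeroʳ (suc j))) ⟩
    outdeg M s + 0             ≡⟨ +-identityʳ _ ⟩
    outdeg M s                 ∎
    where open ≤-Reasoning

  isFlow-deficit : ∀ {M j w} → IsFlow M j → Deficit M w → w ≡ t
  isFlow-deficit {M} {j} {w} M-flow w-deficit with w ≟ t
  ... | yes w≡t = w≡t
  ... | no  w≢t = ⊥-elim (<⇒≱ w-deficit (begin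
    indeg M w              ≤⟨ m≤m+n _ _ ⟩
    indeg M w + j * δ w s  ≡⟨ M-flow w ⟨
    outdeg M w + j * δ w t ≡⟨ cong (outdeg M w +_) (trans (cong (j *_) (δ-≢ w≢t)) (*-zeroʳ j)) ⟩
    outdeg M w + 0         ≡⟨ +-identityʳ _ ⟩
    outdeg M w             ∎))
    where open ≤-Reasoning

  ArcDisjointPaths : Digraph n → ℕ → Set
  ArcDisjointPaths M j = Σ (Fin j → List (Fin n)) λ P →
    (∀ i → endpoint s (P i) ≡ t × PathIn M s (P i)) ×
    (∀ i i' → i ≢ i' → ∀ e → e ∈ steps s (P i) → e ∈ steps s (P i') → ⊥)

  ∷-arcDisjointPaths : ∀ {M j} p → PathIn M s p → endpoint s p ≡ t →
    ArcDisjointPaths (M ∖ fromArcs (steps s p)) j → ArcDisjointPaths M (suc j)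
  ∷-arcDisjointPaths {M} {j} p p-path p-end (P , P-paths , P-disjoint) = Q , Q-paths , Q-disjoint
    where
    N = fromArcs (steps s p)
    Q : Fin (suc j) → List (Fin n)
    Q zero    = p
    Q (suc i) = P i
    Q-paths : ∀ i → endpoint s (Q i) ≡ t × PathIn M s (Q i)
    Q-paths zero    = p-end , p-path
    Q-paths (suc i) = proj₁ (P-paths i) , ⊆ᵈ-path (∖-⊆ᵈ M N) (proj₂ (P-paths i))
    avoids-p : ∀ i e → e ∈ steps s p → e ∈ steps s (P i) → ⊥
    avoids-p i e e∈p e∈Pi = true≢false (trans (sym (All.lookup (proj₂ (proj₂ (P-paths i))) e∈Pi))
                                                (∖-removes M N (fromArcs-complete _ e∈p)))
    Q-disjoint : ∀ i i' → i ≢ i' → ∀ e → e ∈ steps s (Q i) → e ∈ steps s (Q i') → ⊥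
    Q-disjoint zero    zero     i≢i' = ⊥-elim (i≢i' refl)
    Q-disjoint zero    (suc i') _    e e∈p  e∈Pi = avoids-p i' e e∈p e∈Pi
    Q-disjoint (suc i) zero     _    e e∈Pi e∈p  = avoids-p i e e∈p e∈Pi
    Q-disjoint (suc i) (suc i') i≢i' = P-disjoint i i' (i≢i' ∘ cong suc)

  flow-decomposition : ∀ j M → s ≢ t → Irreflexive M → IsFlow M j → ArcDisjointPaths M j
  flow-decomposition zero    M _   _   _      = (λ ()) , (λ ()) , (λ ())
  flow-decomposition (suc j) M s≢t irr M-flow =
    let p , p-path , p-deficit = path-to-deficit (size M) M s ≤-refl irr (isFlow-surplus {M} {j} s≢t M-flow)
        p-end = isFlow-deficit {M} {suc j} M-flow p-deficit
        N = fromArcs (steps s p)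
        N⊆M = fromArcs-⊆ᵈ (steps s p) (proj₂ p-path)
    in  ∷-arcDisjointPaths p p-path p-end
          (flow-decomposition j (M ∖ N) s≢t (⊆ᵈ-irreflexive (∖-⊆ᵈ M N) irr)
                              (isFlow-∖ {M} {N} 1 j N⊆M (path-isFlow p (proj₁ p-path) p-end) M-flow))

-- Cycles and topological orders

module _ {n : ℕ} where

  open import Data.List.Membership.DecPropositional (_≟_ {n}) using (_∈?_)

  steps-snoc : ∀ (a : Fin n) l z → steps a (l ++ [ z ]) ≡ steps a l ++ [ (endpoint a l , z) ]
  steps-snoc a []      z = refl
  steps-snoc a (b ∷ l) z = cong ((a , b) ∷_) (steps-snoc b l z)

  endpoint-snoc : ∀ (a : Fin n) l z → endpoint a (l ++ [ z ]) ≡ z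
  endpoint-snoc a []      z = refl
  endpoint-snoc a (b ∷ l) z = endpoint-snoc b l z

  tails-snoc : ∀ (a : Fin n) l z → map proj₁ (steps a (l ++ [ z ])) ≡ a ∷ l
  tails-snoc a []      z = refl
  tails-snoc a (b ∷ l) z = cong (a ∷_) (tails-snoc b l z)

  unique-snoc : ∀ (x : Fin n) xs → Unique (x ∷ xs) → Unique (xs ++ [ x ])
  unique-snoc x []       _                                 = [] ∷ []
  unique-snoc x (y ∷ xs) ((x≢y ∷ x∉xs) ∷ y∉xs ∷ xs-unique) =
    All.++⁺ y∉xs ((x≢y ∘ sym) ∷ []) ∷ unique-snoc x xs (x∉xs ∷ xs-unique)

  first-arc : ∀ (c : Fin n) rest → ∃ λ c₁ → (c , c₁) ∈ steps c (rest ++ [ c ])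
  first-arc c []         = c , here refl
  first-arc c (r ∷ rest) = r , here refl

  Cycle : Digraph n → Set
  Cycle M = ∃₂ λ c rest → Unique (c ∷ rest) × ArcsIn M (steps c (rest ++ [ c ]))

  cycle-isFlow : ∀ (s t c : Fin n) rest → Unique (c ∷ rest) → IsFlow s t (fromArcs (steps c (rest ++ [ c ]))) 0
  cycle-isFlow s t c rest unique v = cong (_+ 0) (+-cancelʳ-≡ (δ v c) _ _
    (subst (λ e → outdeg C v + δ v e ≡ indeg C v + δ v c) (endpoint-snoc c rest c)
      (walk-degree-balance c (rest ++ [ c ]) (subst Unique (sym (tails-snoc c rest c)) unique)
                           (unique-snoc c rest unique) v)))
    where C = fromArcs (steps c (rest ++ [ c ]))

  prefix-to : ∀ {M : Digraph n} (z v : Fin n) q → z ∈ v ∷ q → PathIn M v q →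
    ∃ λ pre → PathIn M v pre × endpoint v pre ≡ z × pre ⊆ q
  prefix-to z v q       (here refl) _ = [] , ([] ∷ [] , []) , refl , λ ()
  prefix-to z v []      (there ())
  prefix-to z v (w ∷ q) (there z∈)  (v∉ ∷ unique , Mvw ∷ arcs) =
    let pre , (w∷pre-unique , pre-arcs) , pre-end , pre⊆q = prefix-to z w q z∈ (unique , arcs)
    in  w ∷ pre , (All.tabulate (All.lookup v∉ ∘ ∷⁺ʳ w pre⊆q) ∷ w∷pre-unique , Mvw ∷ pre-arcs) ,
        pre-end , ∷⁺ʳ w pre⊆q

  cycle-from-walk : ∀ {M : Digraph n} (y : Fin n) ys z → z ∈ y ∷ ys → PathIn M y ys → M z y ≡ true → Cycle M
  cycle-from-walk {M} y ys z z∈walk walk Mzy =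
    let pre , (unique , arcs) , pre-end , _ = prefix-to z y ys z∈walk walk
        closing : ArcsIn M [ (endpoint y pre , y) ]
        closing = subst (λ x → M x y ≡ true) (sym pre-end) Mzy ∷ []
    in  y , pre , unique , subst (ArcsIn M) (sym (steps-snoc y pre y)) (All.++⁺ arcs closing)

  Source : Digraph n → List (Fin n) → Set
  Source M R = ∃ λ v → v ∈ R × (∀ x → x ∈ R → M x v ≡ false)

  predecessor? : ∀ (M : Digraph n) R y → (∃ λ x → x ∈ R × M x y ≡ true) ⊎ (∀ x → x ∈ R → M x y ≡ false)
  predecessor? M R y with any? (λ x → M x y ≟ᵇ true) R
  ... | yes ∃pred = inj₁ (find ∃pred)
  ... | no  ∄pred = inj₂ (λ x x∈R → ¬-not (All.lookup (All.¬Any⇒All¬ R ∄pred) x∈R))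

  -- The fuel f runs out only when the walk has more vertices than R, which is impossible.
  walk-back : ∀ (M : Digraph n) R f y ys → PathIn M y ys → All (_∈ R) (y ∷ ys) → length R < length (y ∷ ys) + f →
    Cycle M ⊎ Source M R
  walk-back M R zero y ys (unique , _) walk⊆R R<walk =
    ⊥-elim (<⇒≱ (subst (length R <_) (+-identityʳ _) R<walk) (length-⊆ unique walk⊆R))
  walk-back M R (suc f) y ys walk walk⊆R R<walk with predecessor? M R y
  ... | inj₂ no-pred = inj₂ (y , All.head walk⊆R , no-pred)
  ... | inj₁ (z , z∈R , Mzy) with z ∈? y ∷ ys
  ...   | yes z∈walk = inj₁ (cycle-from-walk y ys z z∈walk walk Mzy)
  ...   | no  z∉walk = walk-back M R f z (y ∷ ys)
                         (All.¬Any⇒All¬ (y ∷ ys) z∉walk ∷ proj₁ walk , Mzy ∷ proj₂ walk)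
                         (z∈R ∷ walk⊆R) (subst (length R <_) (+-suc _ f) R<walk)

  TopologicalOrder : Digraph n → Set
  TopologicalOrder M = Σ (Fin n → ℕ) λ ρ → Injective _≡_ _≡_ ρ × (∀ x y → M x y ≡ true → ρ x < ρ y)

  OrderedOn : Digraph n → List (Fin n) → (Fin n → ℕ) → Set
  OrderedOn M R ρ = ∀ {x y} → x ∈ R → y ∈ R → (ρ x ≡ ρ y → x ≡ y) × (M x y ≡ true → ρ x < ρ y)

  ordering-on : ∀ (M : Digraph n) f R → length R ≤ f → Cycle M ⊎ Σ (Fin n → ℕ) (OrderedOn M R)
  ordering-on M f       []      _     = inj₂ (const 0 , λ ())
  ordering-on M (suc f) (r ∷ R) R≤1+f
    with walk-back M (r ∷ R) (length (r ∷ R)) r [] ([] ∷ [] , []) (here refl ∷ []) ≤-refl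
  ... | inj₁ cycle = inj₁ cycle
  ... | inj₂ (v , v∈R , no-pred) with ordering-on M f (filter (λ x → ¬? (x ≟ v)) (r ∷ R)) R-v≤f
    where
    R-v≤f = ≤-pred (≤-trans (filter-notAll (λ x → ¬? (x ≟ v)) (r ∷ R) (Any.map (λ v≡x x≢v → x≢v (sym v≡x)) v∈R))
                            R≤1+f)
  ...   | inj₁ cycle         = inj₁ cycle
  ...   | inj₂ (ρ , ordered) = inj₂ (ρ' , ordered')
    where
    ρ' : Fin n → ℕ
    ρ' x = if does (x ≟ v) then 0 else suc (ρ x)
    ordered' : OrderedOn M (r ∷ R) ρ'
    ordered' {x} {y} x∈R y∈R with x ≟ v | y ≟ v
    ... | yes refl | yes refl = (λ _ → refl) , λ Mvv → ⊥-elim (true≢false (trans (sym Mvv) (no-pred v x∈R)))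
    ... | yes refl | no  _    = (λ ()) , λ _ → z<s
    ... | no  _    | yes refl = (λ ()) , λ Mxv → ⊥-elim (true≢false (trans (sym Mxv) (no-pred x x∈R)))
    ... | no  x≢v  | no  y≢v  =
      let injective , increasing = ordered (∈.∈-filter⁺ (λ x → ¬? (x ≟ v)) x∈R x≢v)
                                           (∈.∈-filter⁺ (λ x → ¬? (x ≟ v)) y∈R y≢v)
      in  injective ∘ suc-injective , s≤s ∘ increasing

  cycle-or-topologicalOrder : ∀ M → Cycle M ⊎ TopologicalOrder M
  cycle-or-topologicalOrder M with ordering-on M (length (allFin n)) (allFin n) ≤-refl
  ... | inj₁ cycle         = inj₁ cycle
  ... | inj₂ (ρ , ordered) = inj₂ (ρ , (λ {x} {y} → proj₁ (ordered (∈.∈-allFin x) (∈.∈-allFin y))) ,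
                                       λ x y → proj₂ (ordered (∈.∈-allFin x) (∈.∈-allFin y)))

-- Distinct pairs with bounded first coordinate

weight : List (ℕ × ℕ) → ℕ
weight xs = sumˡ (map proj₂ xs)

weight-++ : ∀ xs ys → weight (xs ++ ys) ≡ weight xs + weight ys
weight-++ xs ys = trans (cong sumˡ (map-++ proj₂ xs ys)) (sum-++ (map proj₂ xs) _)

ones : List (ℕ × ℕ) → List ℕ
ones []                       = []
ones ((h , zero)        ∷ xs) = ones xs
ones ((h , suc zero)    ∷ xs) = h ∷ ones xs
ones ((h , suc (suc d)) ∷ xs) = ones xs

lowered : List (ℕ × ℕ) → List (ℕ × ℕ)
lowered []                       = []
lowered ((h , zero)        ∷ xs) = lowered xs
lowered ((h , suc zero)    ∷ xs) = lowered xs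
lowered ((h , suc (suc d)) ∷ xs) = (h , suc d) ∷ lowered xs

Positive : List (ℕ × ℕ) → Set
Positive = All (λ p → 1 ≤ proj₂ p)

length-ones+lowered : ∀ xs → Positive xs → length xs ≡ length (ones xs) + length (lowered xs)
length-ones+lowered []                        _       = refl
length-ones+lowered ((h , suc zero)    ∷ xs) (_ ∷ pos) = cong suc (length-ones+lowered xs pos)
length-ones+lowered ((h , suc (suc d)) ∷ xs) (_ ∷ pos) =
  trans (cong suc (length-ones+lowered xs pos)) (sym (+-suc _ _))

weight-lowered : ∀ xs → Positive xs → weight xs ≡ length xs + weight (lowered xs)
weight-lowered []                        _       = refl
weight-lowered ((h , suc zero)    ∷ xs) (_ ∷ pos) = cong suc (weight-lowered xs pos)
weight-lowered ((h , suc (suc d)) ∷ xs) (_ ∷ pos) = cong suc (begin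
  suc d + weight xs                           ≡⟨ cong (suc d +_) (weight-lowered xs pos) ⟩
  suc d + (length xs + weight (lowered xs))   ≡⟨ x∙yz≈y∙xz (suc d) (length xs) _ ⟩
  length xs + (suc d + weight (lowered xs))   ∎)
  where
  open ≡-Reasoning

∈-ones : ∀ xs {h} → h ∈ ones xs → (h , 1) ∈ xs
∈-ones ((_ , zero)        ∷ xs) h∈         = there (∈-ones xs h∈)
∈-ones ((_ , suc zero)    ∷ xs) (here refl) = here refl
∈-ones ((_ , suc zero)    ∷ xs) (there h∈) = there (∈-ones xs h∈)
∈-ones ((_ , suc (suc d)) ∷ xs) h∈         = there (∈-ones xs h∈)

∈-lowered : ∀ xs {h d} → (h , d) ∈ lowered xs → (h , suc d) ∈ xs
∈-lowered ((_ , zero)        ∷ xs) hd∈         = there (∈-lowered xs hd∈)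
∈-lowered ((_ , suc zero)    ∷ xs) hd∈         = there (∈-lowered xs hd∈)
∈-lowered ((_ , suc (suc d)) ∷ xs) (here refl) = here refl
∈-lowered ((_ , suc (suc d)) ∷ xs) (there hd∈) = there (∈-lowered xs hd∈)

ones-unique : ∀ xs → Unique xs → Unique (ones xs)
ones-unique []                        _               = []
ones-unique ((h , zero)        ∷ xs) (_ ∷ xs-unique) = ones-unique xs xs-unique
ones-unique ((h , suc zero)    ∷ xs) (x∉ ∷ xs-unique) =
  All.tabulate (λ h'∈ h≡h' → All.lookup x∉ (∈-ones xs h'∈) (cong (_, 1) h≡h')) ∷ ones-unique xs xs-unique
ones-unique ((h , suc (suc d)) ∷ xs) (_ ∷ xs-unique) = ones-unique xs xs-unique

lowered-unique : ∀ xs → Unique xs → Unique (lowered xs)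
lowered-unique []                        _               = []
lowered-unique ((h , zero)        ∷ xs) (_ ∷ xs-unique) = lowered-unique xs xs-unique
lowered-unique ((h , suc zero)    ∷ xs) (_ ∷ xs-unique) = lowered-unique xs xs-unique
lowered-unique ((h , suc (suc d)) ∷ xs) (x∉ ∷ xs-unique) =
  All.tabulate (λ hd∈ x≡ → All.lookup x∉ (∈-lowered xs hd∈) (cong (λ (h , d) → h , suc d) x≡))
    ∷ lowered-unique xs xs-unique

module _ (u : ℕ) where

  Valid : List (ℕ × ℕ) → Set
  Valid = All (λ p → proj₁ p < u × 1 ≤ proj₂ p)

  lowered-valid : ∀ xs → Valid xs → Valid (lowered xs)
  lowered-valid []                        _            = []
  lowered-valid ((h , zero)        ∷ xs) (_ ∷ valid) = lowered-valid xs valid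
  lowered-valid ((h , suc zero)    ∷ xs) (_ ∷ valid) = lowered-valid xs valid
  lowered-valid ((h , suc (suc d)) ∷ xs) ((h<u , _) ∷ valid) = (h<u , s≤s z≤n) ∷ lowered-valid xs valid

  length-ones≤ : ∀ xs → Unique xs → Valid xs → length (ones xs) ≤ u
  length-ones≤ xs xs-unique valid = subst (length (ones xs) ≤_) (length-upTo u)
    (length-⊆ (ones-unique xs xs-unique) (All.tabulate (∈.∈-upTo⁺ ∘ proj₁ ∘ All.lookup valid ∘ ∈-ones xs)))

  square-step : ∀ c r w → c ≤ u → r * r + r * u ≤ 2 * u * w →
    (c + r) * (c + r) + (c + r) * u ≤ 2 * u * ((c + r) + w)
  square-step c r w c≤u ih = begin
    (c + r) * (c + r) + (c + r) * u              ≡⟨ expand c r u ⟩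
    c * c + 2 * c * r + c * u + (r * r + r * u)
      ≤⟨ +-mono-≤ (+-mono-≤ (+-mono-≤ (*-monoʳ-≤ c c≤u) (*-monoˡ-≤ r (*-monoʳ-≤ 2 c≤u))) ≤-refl) ih ⟩
    c * u + 2 * u * r + c * u + 2 * u * w        ≡⟨ collect c r u w ⟩
    2 * u * ((c + r) + w)                        ∎
    where
    open ≤-Reasoning
    expand : ∀ c r u → (c + r) * (c + r) + (c + r) * u ≡ c * c + 2 * c * r + c * u + (r * r + r * u)
    expand = solve-∀
    collect : ∀ c r u w → c * u + 2 * u * r + c * u + 2 * u * w ≡ 2 * u * ((c + r) + w)
    collect = solve-∀

  -- The pairs with d = 1 have distinct first coordinates below u, so there are at most u of them;
  -- lowering d by one in the remaining pairs leaves an instance of smaller weight.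
  square-bound′ : ∀ f xs → weight xs ≤ f → Unique xs → Valid xs →
    length xs * length xs + length xs * u ≤ 2 * u * weight xs
  square-bound′ _       []             _   _         _               = z≤n
  square-bound′ zero    ((h , d) ∷ xs) w≤0 _         ((_ , 1≤d) ∷ _) =
    ⊥-elim (n≮0 (≤-trans (≤-trans 1≤d (m≤m+n d _)) w≤0))
  square-bound′ (suc f) xs@(_ ∷ _)     w≤f xs-unique valid         =
    subst₂ (λ l w → l * l + l * u ≤ 2 * u * w) (sym length≡) (sym weight≡)
      (square-step (length (ones xs)) (length (lowered xs)) (weight (lowered xs))
        (length-ones≤ xs xs-unique valid)
        (square-bound′ f (lowered xs) lowered≤f (lowered-unique xs xs-unique) (lowered-valid xs valid)))
    where
    positive : Positive xs
    positive = All.map proj₂ valid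
    length≡ = length-ones+lowered xs positive
    weight≡ : weight xs ≡ length (ones xs) + length (lowered xs) + weight (lowered xs)
    weight≡ = trans (weight-lowered xs positive) (cong (_+ weight (lowered xs)) length≡)
    lowered≤f : weight (lowered xs) ≤ f
    lowered≤f = ≤-pred (≤-trans (+-monoˡ-≤ (weight (lowered xs)) (s≤s z≤n))
                                (subst (_≤ suc f) (weight-lowered xs positive) w≤f))

  square-bound : ∀ xs → Unique xs → Valid xs → length xs * length xs + length xs * u ≤ 2 * u * weight xs
  square-bound xs = square-bound′ (weight xs) xs ≤-refl

-- Minimally k-st-edge-connected graphs

module _ {n : ℕ} (s : Fin n) where

  pathsDigraph : ∀ j → (Fin j → List (Fin n)) → Digraph n
  pathsDigraph zero    P = λ _ _ → false
  pathsDigraph (suc j) P = fromArcs (steps s (P zero)) ∪ pathsDigraph j (P ∘ suc)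

  pathsDigraph-sound : ∀ j P {x y} → pathsDigraph j P x y ≡ true → ∃ λ i → (x , y) ∈ steps s (P i)
  pathsDigraph-sound (suc j) P {x} {y} xy∈ with fromArcs (steps s (P zero)) x y in in-head
  ... | true  = zero , fromArcs-sound _ in-head
  ... | false = let i , xy∈Pi = pathsDigraph-sound j (P ∘ suc) xy∈ in suc i , xy∈Pi

  pathsDigraph-complete : ∀ j P i {x y} → (x , y) ∈ steps s (P i) → pathsDigraph j P x y ≡ true
  pathsDigraph-complete (suc j) P zero {x} {y} xy∈ = cong (_∨ pathsDigraph j (P ∘ suc) x y) (fromArcs-complete _ xy∈)
  pathsDigraph-complete (suc j) P (suc i)         xy∈ = ∨-trueʳ _ (pathsDigraph-complete j (P ∘ suc) i xy∈)

module _ {n : ℕ} (E : List (Edge n)) (s t : Fin n) where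

  pathsDigraph-isFlow : ∀ j P → (∀ i → IsPath E s t (P i)) → (∀ i i' → i ≢ i' → EdgeDisjoint s (P i) (P i')) →
    IsFlow s t (pathsDigraph s j P) j
  pathsDigraph-isFlow zero    P _      _        v = refl
  pathsDigraph-isFlow (suc j) P isPath disjoint =
    isFlow-∪ s t {fromArcs (steps s (P zero))} {pathsDigraph s j (P ∘ suc)} 1 j
      (λ x y → ∧-≡false λ in-head in-tail →
        let i , xy∈Pi = pathsDigraph-sound s j (P ∘ suc) in-tail
        in  disjoint zero (suc i) (λ ()) _ _ (fromArcs-sound _ in-head) xy∈Pi (inj₁ (refl , refl)))
      (path-isFlow s t (P zero) (proj₁ (proj₂ (isPath zero))) (proj₁ (isPath zero)))
      (pathsDigraph-isFlow j (P ∘ suc) (isPath ∘ suc)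
                           (λ i i' i≢i' → disjoint (suc i) (suc i') (i≢i' ∘ suc-injectiveᶠ)))

undirected : ∀ {n} → Digraph n → Edge n → Bool
undirected M (x , y) = M x y ∨ M y x

module Minimal {n : ℕ} (G : SimpleGraph n) {s t : Fin n} {k : ℕ} (s≢t : s ≢ t)
                (minimal : MinimallyEdgeConnected G s t k) where

  private
    E = edges G
    isPath = proj₁ (proj₂ (proj₁ minimal))
    disjoint = proj₂ (proj₂ (proj₁ minimal))

  P : Fin k → List (Fin n)
  P = proj₁ (proj₁ minimal)

  M : Digraph n
  M = pathsDigraph s k P

  antisymmetric : ∀ {x y} → M x y ≡ true → M y x ≡ true → ⊥
  antisymmetric Mxy Myx with pathsDigraph-sound s k P Mxy | pathsDigraph-sound s k P Myx
  ... | i , xy∈Pi | i' , yx∈Pi' with i ≟ i'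
  ... | yes refl = steps-antisymmetric s (P i) (proj₁ (proj₂ (isPath i))) xy∈Pi yx∈Pi'
  ... | no  i≢i' = disjoint i i' i≢i' _ _ xy∈Pi yx∈Pi' (inj₂ (refl , refl))

  irreflexive : Irreflexive M
  irreflexive x = ¬-not (λ Mxx → antisymmetric Mxx Mxx)

  arc⇒adj : ∀ {x y} → M x y ≡ true → Adj E x y
  arc⇒adj Mxy = let i , xy∈Pi = pathsDigraph-sound s k P Mxy in All.lookup (proj₂ (proj₂ (isPath i))) xy∈Pi

  -- Decomposing M' gives k edge-disjoint s-t paths using only edges that M' orients.
  no-smaller-flow : ∀ M' → M' ⊆ᵈ M → IsFlow s t M' k → ∀ {e} → e ∈ E → undirected M' e ≡ false → ⊥
  no-smaller-flow M' M'⊆M M'-flow {e} e∈E e-unused =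
    proj₂ minimal E' (All.tabulate (proj₁ ∘ ∈-filterᵇ⁻ (undirected M') {xs = E}))
                     (e , e∈E , e∉E') (Q , Q-paths , Q-disjoint)
    where
    E' = filterᵇ (undirected M') E
    e∉E' : e ∉ E'
    e∉E' e∈E' = true≢false (trans (sym (proj₂ (∈-filterᵇ⁻ (undirected M') {xs = E} e∈E'))) e-unused)
    decomposition = flow-decomposition s t k M' s≢t (⊆ᵈ-irreflexive M'⊆M irreflexive) M'-flow
    Q = proj₁ decomposition
    arc-kept : ∀ {x y} → M' x y ≡ true → Adj E' x y
    arc-kept {x} {y} M'xy with arc⇒adj (M'⊆M x y M'xy)
    ... | inj₁ xy∈E = inj₁ (∈-filterᵇ⁺ (undirected M') xy∈E (cong (_∨ M' y x) M'xy))
    ... | inj₂ yx∈E = inj₂ (∈-filterᵇ⁺ (undirected M') yx∈E (∨-trueʳ (M' y x) M'xy))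
    Q-paths : ∀ i → IsPath E' s t (Q i)
    Q-paths i = let end , unique , arcs = proj₁ (proj₂ decomposition) i
                in  end , unique , All.map arc-kept arcs
    Q-disjoint : ∀ i i' → i ≢ i' → EdgeDisjoint s (Q i) (Q i')
    Q-disjoint i i' i≢i' e f e∈Qi f∈Qi' (inj₁ (refl , refl)) = proj₂ (proj₂ decomposition) i i' i≢i' e e∈Qi f∈Qi'
    Q-disjoint i i' i≢i' e f e∈Qi f∈Qi' (inj₂ (refl , refl)) =
      antisymmetric (M'⊆M _ _ (All.lookup (proj₂ (proj₂ (proj₁ (proj₂ decomposition) i))) e∈Qi))
                    (M'⊆M _ _ (All.lookup (proj₂ (proj₂ (proj₁ (proj₂ decomposition) i'))) f∈Qi'))

  isFlow : IsFlow s t M k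
  isFlow = pathsDigraph-isFlow E s t k P isPath disjoint

  covers : ∀ {e} → e ∈ E → undirected M e ≡ true
  covers e∈E = ¬-not (no-smaller-flow M (λ _ _ → id) isFlow e∈E)

  covered : ∀ {x y} → (x , y) ∈ E → ∃ λ i → (x , y) ∈ steps s (P i) ⊎ (y , x) ∈ steps s (P i)
  covered {x} {y} xy∈E with M x y in Mxy | covers xy∈E
  ... | true  | _   = let i , xy∈Pi = pathsDigraph-sound s k P Mxy in i , inj₁ xy∈Pi
  ... | false | Myx = let i , yx∈Pi = pathsDigraph-sound s k P Myx in i , inj₂ yx∈Pi

  acyclic : Cycle M → ⊥
  acyclic (c , rest , unique , arcs) = unused (arc⇒adj Mcc₁)
    where
    C = fromArcs (steps c (rest ++ [ c ]))
    M' = M ∖ C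
    M'-flow : IsFlow s t M' k
    M'-flow = isFlow-∖ s t {M} {C} 0 k (fromArcs-⊆ᵈ _ arcs) (cycle-isFlow s t c rest unique) isFlow
    c₁ = proj₁ (first-arc c rest)
    Mcc₁ : M c c₁ ≡ true
    Mcc₁ = All.lookup arcs (proj₂ (first-arc c rest))
    M'cc₁ : M' c c₁ ≡ false
    M'cc₁ = ∖-removes M C (fromArcs-complete _ (proj₂ (first-arc c rest)))
    M'c₁c : M' c₁ c ≡ false
    M'c₁c = ¬-not (antisymmetric Mcc₁ ∘ ∖-⊆ᵈ M C c₁ c)
    unused : Adj E c c₁ → ⊥
    unused (inj₁ cc₁∈E) = no-smaller-flow M' (∖-⊆ᵈ M C) M'-flow cc₁∈E (cong₂ _∨_ M'cc₁ M'c₁c)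
    unused (inj₂ c₁c∈E) = no-smaller-flow M' (∖-⊆ᵈ M C) M'-flow c₁c∈E (cong₂ _∨_ M'c₁c M'cc₁)

  topologicalOrder : TopologicalOrder M
  topologicalOrder = [ ⊥-elim ∘ acyclic , id ]′ (cycle-or-topologicalOrder M)

-- Counting the edges inside U

canonical-unique : ∀ {n} {e e' : Edge n} {a b} → proj₁ e <ᶠ proj₂ e → proj₁ e' <ᶠ proj₂ e' →
  e ≡ (a , b) ⊎ e ≡ (b , a) → e' ≡ (a , b) ⊎ e' ≡ (b , a) → e ≡ e'
canonical-unique _   _   (inj₁ refl) (inj₁ refl) = refl
canonical-unique _   _   (inj₂ refl) (inj₂ refl) = refl
canonical-unique a<b b<a (inj₁ refl) (inj₂ refl) = ⊥-elim (<ᶠ-asym a<b b<a)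
canonical-unique b<a a<b (inj₂ refl) (inj₁ refl) = ⊥-elim (<ᶠ-asym b<a a<b)

module Counting {n : ℕ} (G : SimpleGraph n) (U : Subset n) (s : Fin n) {k : ℕ} (P : Fin k → List (Fin n))
  (ρ : Fin n → ℕ) (ρ-injective : Injective _≡_ _≡_ ρ)
  (ρ-increasing : ∀ i {x y} → (x , y) ∈ steps s (P i) → ρ x < ρ y)
  (covered : ∀ {x y} → (x , y) ∈ edges G → ∃ λ i → (x , y) ∈ steps s (P i) ⊎ (y , x) ∈ steps s (P i)) where

  inU : Fin n → Bool
  inU = lookup U

  precedes : Fin n → Fin n → Bool
  precedes z v = ρ z <ᵇ ρ v

  precedes-sound : ∀ {z v} → precedes z v ≡ true → ρ z < ρ v
  precedes-sound z≺v = <ᵇ⇒< _ _ (Equivalence.from T-≡ z≺v)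

  precedes-complete : ∀ {z v} → ρ z < ρ v → precedes z v ≡ true
  precedes-complete = Equivalence.to T-≡ ∘ <⇒<ᵇ

  precedes-false : ∀ {z v} → ¬ ρ z < ρ v → precedes z v ≡ false
  precedes-false z≮v = ¬-not (z≮v ∘ precedes-sound)

  below : Fin n → Fin n → Bool
  below v z = inU z ∧ precedes z v

  rank : Fin n → ℕ
  rank v = count (below v)

  not-below-self : ∀ v → below v v ≡ false
  not-below-self v = trans (cong (inU v ∧_) (precedes-false (<-irrefl refl))) (∧-zeroʳ (inU v))

  below-mono : ∀ {v w} → ρ v < ρ w → ∀ z → below v z ≡ true → below w z ≡ true
  below-mono v<w z z-below =
    let z∈U , z≺v = ∧-≡true z-below in cong₂ _∧_ z∈U (precedes-complete (<-trans (precedes-sound z≺v) v<w))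

  below⊆U : ∀ v z → below v z ≡ true → inU z ≡ true
  below⊆U v z = proj₁ ∘ ∧-≡true

  rank-mono-≤ : ∀ {v w} → ρ v < ρ w → rank v ≤ rank w
  rank-mono-≤ {v} {w} v<w = count-mono-≤ {p = below v} {below w} (below-mono v<w)

  rank-mono-< : ∀ {v w} → ρ v < ρ w → inU v ≡ true → rank v < rank w
  rank-mono-< {v} {w} v<w v∈U = count-mono-< {p = below v} {below w} (below-mono v<w) v (not-below-self v)
                                             (cong₂ _∧_ v∈U (precedes-complete v<w))

  rank≤∣U∣ : ∀ v → rank v ≤ ∣ U ∣
  rank≤∣U∣ v = subst (rank v ≤_) (sym (∣p∣≡count U)) (count-mono-≤ {p = below v} {inU} (below⊆U v))

  rank<∣U∣ : ∀ {v} → inU v ≡ true → rank v < ∣ U ∣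
  rank<∣U∣ {v} v∈U =
    subst (rank v <_) (sym (∣p∣≡count U)) (count-mono-< {p = below v} {inU} (below⊆U v) v (not-below-self v) v∈U)

  rank-injective : ∀ {v w} → inU v ≡ true → inU w ≡ true → rank v ≡ rank w → v ≡ w
  rank-injective {v} {w} v∈U w∈U rv≡rw with <-cmp (ρ v) (ρ w)
  ... | tri< v<w _ _ = ⊥-elim (<⇒≢ (rank-mono-< v<w v∈U) rv≡rw)
  ... | tri≈ _ ρv≡ρw _ = ρ-injective ρv≡ρw
  ... | tri> _ _ w<v = ⊥-elim (<⇒≢ (rank-mono-< w<v w∈U) (sym rv≡rw))

  arcPair : Arc n → ℕ × ℕ
  arcPair (a , b) = rank b , rank b ∸ rank a

  pairOf : Arc n → List (ℕ × ℕ)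
  pairOf (a , b) = if inU a ∧ inU b then [ arcPair (a , b) ] else []

  arcPair∈pairOf : ∀ {a b} → inU a ≡ true → inU b ≡ true → arcPair (a , b) ∈ pairOf (a , b)
  arcPair∈pairOf a∈U b∈U rewrite a∈U | b∈U = here refl

  pairOf-weight : ∀ {a b} → ρ a < ρ b → weight (pairOf (a , b)) + rank a ≤ rank b
  pairOf-weight {a} {b} a<b with inU a ∧ inU b
  ... | true  = ≤-reflexive (trans (cong (_+ rank a) (+-identityʳ _)) (m∸n+n≡m (rank-mono-≤ a<b)))
  ... | false = rank-mono-≤ a<b

  walk-weight : ∀ a l → (∀ {x y} → (x , y) ∈ steps a l → ρ x < ρ y) →
    weight (concatMap pairOf (steps a l)) + rank a ≤ rank (endpoint a l)
  walk-weight a []      _          = ≤-refl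
  walk-weight a (b ∷ l) increasing = begin
    weight (pairOf (a , b) ++ rest) + rank a          ≡⟨ cong (_+ rank a) (weight-++ (pairOf (a , b)) rest) ⟩
    weight (pairOf (a , b)) + weight rest + rank a    ≡⟨ cong (_+ rank a) (+-comm (weight (pairOf (a , b))) _) ⟩
    weight rest + weight (pairOf (a , b)) + rank a    ≡⟨ +-assoc (weight rest) _ _ ⟩
    weight rest + (weight (pairOf (a , b)) + rank a)
      ≤⟨ +-monoʳ-≤ (weight rest) (pairOf-weight (increasing (here refl))) ⟩
    weight rest + rank b                              ≤⟨ walk-weight b l (increasing ∘ there) ⟩
    rank (endpoint b l)                               ∎
    where
    open ≤-Reasoning
    rest = concatMap pairOf (steps b l)

  pathPairs : ∀ j → (Fin j → List (Fin n)) → List (ℕ × ℕ)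
  pathPairs zero    Q = []
  pathPairs (suc j) Q = concatMap pairOf (steps s (Q zero)) ++ pathPairs j (Q ∘ suc)

  pathPairs-weight : ∀ j Q → (∀ i {x y} → (x , y) ∈ steps s (Q i) → ρ x < ρ y) →
    weight (pathPairs j Q) ≤ j * ∣ U ∣
  pathPairs-weight zero    Q _          = z≤n
  pathPairs-weight (suc j) Q increasing = begin
    weight (pathPairs (suc j) Q)                                 ≡⟨ weight-++ (concatMap pairOf (steps s (Q zero))) _ ⟩
    weight (concatMap pairOf (steps s (Q zero))) + weight (pathPairs j (Q ∘ suc))
      ≤⟨ +-mono-≤ first-path (pathPairs-weight j (Q ∘ suc) (λ i → increasing (suc i))) ⟩
    ∣ U ∣ + j * ∣ U ∣                                            ∎
    where
    open ≤-Reasoning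
    first-path : weight (concatMap pairOf (steps s (Q zero))) ≤ ∣ U ∣
    first-path = ≤-trans (m≤m+n _ (rank s)) (≤-trans (walk-weight s (Q zero) (increasing zero)) (rank≤∣U∣ _))

  ∈-pathPairs : ∀ j Q i {e p} → e ∈ steps s (Q i) → p ∈ pairOf e → p ∈ pathPairs j Q
  ∈-pathPairs (suc j) Q zero    e∈ p∈ = ∈.∈-++⁺ˡ (∈.∈-concat⁺′ p∈ (∈.∈-map⁺ pairOf e∈))
  ∈-pathPairs (suc j) Q (suc i) e∈ p∈ = ∈.∈-++⁺ʳ _ (∈-pathPairs j (Q ∘ suc) i e∈ p∈)

  EU : List (Edge n)
  EU = inducedEdges G U

  ∈-EU⁻ : ∀ {x y} → (x , y) ∈ EU → (x , y) ∈ edges G × inU x ≡ true × inU y ≡ true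
  ∈-EU⁻ xy∈EU = let xy∈E , both∈U = ∈-filterᵇ⁻ _ {xs = edges G} xy∈EU in xy∈E , ∧-≡true both∈U

  edgePair : Edge n → ℕ × ℕ
  edgePair (x , y) = if precedes x y then arcPair (x , y) else arcPair (y , x)

  edgePair-forward : ∀ {a b} → ρ a < ρ b → edgePair (a , b) ≡ arcPair (a , b)
  edgePair-forward a<b rewrite precedes-complete a<b = refl

  edgePair-backward : ∀ {a b} → ρ a < ρ b → edgePair (b , a) ≡ arcPair (a , b)
  edgePair-backward a<b rewrite precedes-false (<-asym a<b) = refl

  Ascending : Arc n → Set
  Ascending (a , b) = inU a ≡ true × inU b ≡ true × ρ a < ρ b

  Orientation : Edge n → Arc n → Set
  Orientation e (a , b) = Ascending (a , b) × edgePair e ≡ arcPair (a , b) × (e ≡ (a , b) ⊎ e ≡ (b , a))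

  orientation : ∀ {e} → e ∈ EU → ∃ (Orientation e)
  orientation {x , y} xy∈EU with ∈-EU⁻ xy∈EU | <-cmp (ρ x) (ρ y)
  ... | _ , x∈U , y∈U | tri< x<y _ _ = (x , y) , (x∈U , y∈U , x<y) , edgePair-forward x<y , inj₁ refl
  ... | _ , x∈U , y∈U | tri> _ _ y<x = (y , x) , (y∈U , x∈U , y<x) , edgePair-backward y<x , inj₂ refl
  ... | xy∈E , _ | tri≈ _ ρx≡ρy _ = ⊥-elim (<ᶠ-irrefl (ρ-injective ρx≡ρy) (All.lookup (canonical G) xy∈E))

  edgePair-valid : ∀ {e} → e ∈ EU → proj₁ (edgePair e) < ∣ U ∣ × 1 ≤ proj₂ (edgePair e)
  edgePair-valid e∈EU with orientation e∈EU
  ... | (a , b) , (a∈U , b∈U , a<b) , e↦ab , _ rewrite e↦ab = rank<∣U∣ b∈U , m<n⇒0<n∸m (rank-mono-< a<b a∈U)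

  arcPair-injective : ∀ {a b a' b'} → Ascending (a , b) → Ascending (a' , b') →
    arcPair (a , b) ≡ arcPair (a' , b') → (a , b) ≡ (a' , b')
  arcPair-injective {a} {b} {a'} {b'} (a∈U , b∈U , a<b) (a'∈U , b'∈U , a'<b') same =
    cong₂ _,_ (rank-injective a∈U a'∈U ra≡ra') (rank-injective b∈U b'∈U rb≡rb')
    where
    open ≡-Reasoning
    rb≡rb' = cong proj₁ same
    ra≡ra' : rank a ≡ rank a'
    ra≡ra' = begin
      rank a                        ≡⟨ m∸[m∸n]≡n (rank-mono-≤ a<b) ⟨
      rank b ∸ (rank b ∸ rank a)    ≡⟨ cong₂ _∸_ rb≡rb' (cong proj₂ same) ⟩
      rank b' ∸ (rank b' ∸ rank a') ≡⟨ m∸[m∸n]≡n (rank-mono-≤ a'<b') ⟩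
      rank a'                       ∎

  edgePair-injective : ∀ {e e'} → e ∈ EU → e' ∈ EU → edgePair e ≡ edgePair e' → e ≡ e'
  edgePair-injective e∈EU e'∈EU same with orientation e∈EU | orientation e'∈EU
  ... | ab , ab-asc , e↦ab , e~ab | ab' , ab'-asc , e'↦ab' , e'~ab'
    with refl ← arcPair-injective ab-asc ab'-asc (trans (sym e↦ab) (trans same e'↦ab'))
    = canonical-unique (canonical-EU e∈EU) (canonical-EU e'∈EU) e~ab e'~ab'
    where
    canonical-EU : ∀ {e} → e ∈ EU → proj₁ e <ᶠ proj₂ e
    canonical-EU {x , y} = All.lookup (canonical G) ∘ proj₁ ∘ ∈-EU⁻

  edgePair∈pathPairs : ∀ {e} → e ∈ EU → edgePair e ∈ pathPairs k P
  edgePair∈pathPairs {x , y} xy∈EU with ∈-EU⁻ xy∈EU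
  ... | xy∈E , x∈U , y∈U with covered xy∈E
  ... | i , inj₁ xy∈Pi rewrite edgePair-forward (ρ-increasing i xy∈Pi) =
    ∈-pathPairs k P i xy∈Pi (arcPair∈pairOf x∈U y∈U)
  ... | i , inj₂ yx∈Pi rewrite edgePair-backward (ρ-increasing i yx∈Pi) =
    ∈-pathPairs k P i yx∈Pi (arcPair∈pairOf y∈U x∈U)

  bound : length EU * length EU ≤ (2 * k) * (∣ U ∣ * ∣ U ∣)
  bound = begin
    L * L                            ≤⟨ m≤m+n (L * L) (L * u) ⟩
    L * L + L * u                    ≡⟨ cong (λ l → l * l + l * u) (length-map edgePair EU) ⟨
    length xs * length xs + length xs * u ≤⟨ square-bound u xs xs-unique xs-valid ⟩
    2 * u * weight xs
      ≤⟨ *-monoʳ-≤ (2 * u) (≤-trans (sum-map-⊆ proj₂ xs-unique xs⊆) (pathPairs-weight k P ρ-increasing)) ⟩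
    2 * u * (k * u)                  ≡⟨ regroup u k ⟩
    (2 * k) * (u * u)                ∎
    where
    open ≤-Reasoning
    L = length EU
    u = ∣ U ∣
    xs = map edgePair EU
    xs-unique : Unique xs
    xs-unique = map-unique edgePair (filter⁺ _ (noDup G)) edgePair-injective
    xs-valid : Valid u xs
    xs-valid = All.map⁺ (All.tabulate edgePair-valid)
    xs⊆ : All (_∈ pathPairs k P) xs
    xs⊆ = All.map⁺ (All.tabulate edgePair∈pathPairs)
    regroup : ∀ u k → 2 * u * (k * u) ≡ (2 * k) * (u * u)
    regroup = solve-∀

no-edges-if-s≡t : ∀ {n} (G : SimpleGraph n) {s k} → MinimallyEdgeConnected G s s k → edges G ≡ []
no-edges-if-s≡t G (_ , minimal) with edges G
... | []    = refl
... | e ∷ _ = ⊥-elim (minimal [] [] (e , here refl , λ ())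
                       ((λ _ → []) , (λ _ → refl , [] ∷ [] , []) , λ _ _ _ _ _ ()))

lemma1 : (n k : ℕ) → 1 ≤ k → (G : SimpleGraph n) → (s t : Fin n) →
    MinimallyEdgeConnected G s t k →
    (U : Subset n) →
    length (inducedEdges G U) * length (inducedEdges G U) ≤ (2 * k) * (∣ U ∣ * ∣ U ∣)
lemma1 n k _ G s t minimal U with s ≟ t
... | yes refl = subst (λ es → length es * length es ≤ (2 * k) * (∣ U ∣ * ∣ U ∣))
                       (sym (cong (filterᵇ _) (no-edges-if-s≡t G minimal))) z≤n
... | no  s≢t  = Counting.bound G U s P ρ ρ-injective ρ-increasing covered
  where
  open Minimal G s≢t minimal
  ρ = proj₁ topologicalOrder
  ρ-injective = proj₁ (proj₂ topologicalOrder)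
  ρ-increasing : ∀ i {x y} → (x , y) ∈ steps s (P i) → ρ x < ρ y
  ρ-increasing i xy∈Pi = proj₂ (proj₂ topologicalOrder) _ _ (pathsDigraph-complete s k P i xy∈Pi)
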